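{- For every integer $n\ge1$, $\widehat{C}_{4,6,n}=2^{n-1}$.
   Context: A $4$-dimensional balanced ballot path of length $4n$ is a sequence of $4n$ standard unit vectors of $\mathbb{R}^4$, each $\vec e_i$ occurring exactly $n$ times, such that every intermediate point (partial sum) $(x_1,\dots,x_4)$ satisfies $x_1\ge x_2\ge x_3\ge x_4$. The semisymmetric height of a point is $g_4(\vec x)=3x_1+x_2-x_3-3x_4$, and the semisymmetric height of a path is the maximum of $g_4$ over its intermediate points. $\widehat{C}_{4,u,n}$ is the number of $4$-dimensional balanced ballot paths of length $4n$ with semisymmetric height at most $u$. -}

module Defs where

open import Data.Nat using (ℕ; zero; suc; _+_; _*_; _≤_; _≤?_; _≟_)
open import Data.Fin using (Fin; zero; suc)
open import Data.List using (List; []; _∷_; length; map; concatMap; filter)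
open import Data.List.Relation.Unary.All using (All; all?)
open import Data.Vec using (Vec; []; _∷_; lookup; updateAt; replicate)
open import Data.Product using (_×_; _,_)
open import Relation.Nullary using (Dec; yes; no)
open import Relation.Nullary.Decidable using (_×-dec_)

-- A step is a standard unit vector e_i of ℝ^4, encoded by its index i : Fin 4
-- (zero = e₁, suc zero = e₂, suc (suc zero) = e₃, suc (suc (suc zero)) = e₄).
Step : Set
Step = Fin 4

-- A lattice point; partial sums of unit vectors have coordinates in ℕ.
Point : Set
Point = Vec ℕ 4

origin : Point
origin = replicate 4 0

addStep : Point → Step → Point
addStep x i = updateAt x i suc

pointsFrom : Point → List Step → List Point
pointsFrom x [] = x ∷ []
pointsFrom x (s ∷ w) = x ∷ pointsFrom (addStep x s) w

points : List Step → List Point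
points = pointsFrom origin

x₁ x₂ x₃ x₄ : Point → ℕ
x₁ x = lookup x zero
x₂ x = lookup x (suc zero)
x₃ x = lookup x (suc (suc zero))
x₄ x = lookup x (suc (suc (suc zero)))

Ballot : Point → Set
Ballot x = (x₂ x ≤ x₁ x) × (x₃ x ≤ x₂ x) × (x₄ x ≤ x₃ x)

ballot? : (x : Point) → Dec (Ballot x)
ballot? x = (x₂ x ≤? x₁ x) ×-dec ((x₃ x ≤? x₂ x) ×-dec (x₄ x ≤? x₃ x))

-- Semisymmetric height g₄(x) = 3x₁ + x₂ - x₃ - 3x₄ is at most u,
-- written without subtraction as 3x₁ + x₂ ≤ u + x₃ + 3x₄ (equivalent over ℤ).
HeightAtMost : ℕ → Point → Set
HeightAtMost u x = 3 * x₁ x + x₂ x ≤ u + x₃ x + 3 * x₄ x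

heightAtMost? : (u : ℕ) (x : Point) → Dec (HeightAtMost u x)
heightAtMost? u x = (3 * x₁ x + x₂ x) ≤? (u + x₃ x + 3 * x₄ x)

-- Balanced: every e_i occurs exactly n times, i.e. the endpoint is (n,n,n,n)
-- (equivalently, since the length is 4n, checked via the final point).
finalPoint : List Step → Point
finalPoint w = go origin w
  where
  go : Point → List Step → Point
  go x [] = x
  go x (s ∷ v) = go (addStep x s) v

Good : ℕ → ℕ → List Step → Set
Good u n w = (finalPoint w ≡ replicate 4 n) × All Ballot (points w) × All (HeightAtMost u) (points w)
  where open import Relation.Binary.PropositionalEquality using (_≡_)

allFin4 : List Step
allFin4 = zero ∷ suc zero ∷ suc (suc zero) ∷ suc (suc (suc zero)) ∷ []

words : ℕ → List (List Step)
words zero = [] ∷ []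
words (suc k) = concatMap (λ s → map (s ∷_) (words k)) allFin4

Chat4 : ℕ → ℕ → ℕ
Chat4 u n = length (filter good? (words (4 * n)))
  where
  open import Data.Vec.Properties using (≡-dec)
  good? : (w : List Step) → Dec (Good u n w)
  good? w = ≡-dec _≟_ (finalPoint w) (replicate 4 n)
            ×-dec (all? ballot? (points w) ×-dec all? (heightAtMost? u) (points w))

{-# OPTIONS --safe #-}
-- Both the ballot condition and g₄ are invariant under translation by (1,1,1,1), so paths
-- of height at most 6 are studied modulo that translation.  Up to it they only visit
-- 0000, 1000, 2000, 1100, 1110 and 2110, and 2000 is a dead end.  Hence a path from the
-- origin is forced to reach 1110 after three steps, from 1110 it reaches 1110 + (1,1,1,1)
-- after four steps in exactly two ways (through 2110 or through 1111), and from
-- (n,n,n,n-1) one last step ends the path: 2ⁿ⁻¹ paths in total.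
module Submission where

open import Defs
open import Data.Nat using (ℕ; zero; suc; _+_; _*_; _^_; _≤_; _≟_; s≤s; s≤s⁻¹)
open import Data.Nat.Properties using (*-comm; +-identityʳ; +-monoʳ-≤; +-cancelˡ-≤)
open import Data.Nat.Solver using (module +-*-Solver)
open import Data.Nat.ListAction using (sum)
open import Data.List using (List; []; _∷_; _++_; length; map; filter; concatMap)
open import Data.List.Properties using (length-++; filter-++; filter-≐; filter-none; map-cong)
open import Data.List.Relation.Unary.All using (All; []; _∷_; all?; universal)
import Data.List.Relation.Unary.All as All
open import Data.List.Relation.Unary.All.Properties using (map⁺; map⁻)
open import Data.Vec using ([]; _∷_; replicate)
import Data.Vec as Vec
open import Data.Vec.Properties using (≡-dec; map-updateAt)
open import Data.Product using (_×_; _,_; proj₁; proj₂)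
open import Function using (_∘_)
open import Relation.Nullary using (¬_; yes; no)
open import Relation.Nullary.Decidable using (_×-dec_; from-yes)
open import Relation.Unary using (Pred; Decidable; _≐_)
open import Relation.Binary.PropositionalEquality
  using (_≡_; refl; sym; trans; cong; cong₂; subst; subst₂; module ≡-Reasoning)

walk : Point → List Step → Point
walk x []      = x
walk x (s ∷ w) = walk (addStep x s) w

-- `finalPoint` runs an anonymous local function, which cannot be named directly.  The
-- metavariable `loop` is solved to it by the `with`-generalised equation below, so that
-- its behaviour from an arbitrary start point can be proved by induction.
mutual
  loop : List Step → Point → List Step → Point
  loop = _

  finalPoint-loop : ∀ s w → finalPoint (s ∷ w) ≡ loop (s ∷ w) (addStep origin s) w
  finalPoint-loop s w with s ∷ w | addStep origin s
  ... | v | x = refl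

loop≡walk : ∀ v x w → loop v x w ≡ walk x w
loop≡walk v x []      = refl
loop≡walk v x (s ∷ w) = loop≡walk v (addStep x s) w

finalPoint≡walk : ∀ w → finalPoint w ≡ walk origin w
finalPoint≡walk []      = refl
finalPoint≡walk (s ∷ w) = trans (finalPoint-loop s w) (loop≡walk (s ∷ w) (addStep origin s) w)

module _ {a p} {A : Set a} {P : Pred A p} (P? : Decidable P) where

  length-filter-concatMap : ∀ {b} {B : Set b} (f : B → List A) xs →
    length (filter P? (concatMap f xs)) ≡ sum (map (length ∘ filter P? ∘ f) xs)
  length-filter-concatMap f []       = refl
  length-filter-concatMap f (x ∷ xs) = begin
    length (filter P? (f x ++ concatMap f xs))
      ≡⟨ cong length (filter-++ P? (f x) (concatMap f xs)) ⟩
    length (filter P? (f x) ++ filter P? (concatMap f xs))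
      ≡⟨ length-++ (filter P? (f x)) ⟩
    length (filter P? (f x)) + length (filter P? (concatMap f xs))
      ≡⟨ cong (length (filter P? (f x)) +_) (length-filter-concatMap f xs) ⟩
    length (filter P? (f x)) + sum (map (length ∘ filter P? ∘ f) xs) ∎
    where open ≡-Reasoning

  length-filter-map : ∀ {b} {B : Set b} (f : B → A) xs →
    length (filter P? (map f xs)) ≡ length (filter (P? ∘ f) xs)
  length-filter-map f []       = refl
  length-filter-map f (x ∷ xs) with P? (f x)
  ... | yes _ = cong suc (length-filter-map f xs)
  ... | no  _ = length-filter-map f xs

  sum-map-filter : (f : A → ℕ) → (∀ x → ¬ P x → f x ≡ 0) → ∀ xs →
    sum (map f (filter P? xs)) ≡ sum (map f xs)
  sum-map-filter f f-vanishes []       = refl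
  sum-map-filter f f-vanishes (x ∷ xs) with P? x
  ... | yes _  = cong (f x +_) (sum-map-filter f f-vanishes xs)
  ... | no ¬px = trans (sum-map-filter f f-vanishes xs)
                       (cong (_+ sum (map f xs)) (sym (f-vanishes x ¬px)))

Admissible : ℕ → Point → Set
Admissible u x = Ballot x × HeightAtMost u x

admissible? : (u : ℕ) → Decidable (Admissible u)
admissible? u x = ballot? x ×-dec heightAtMost? u x

Path : ℕ → Point → Point → List Step → Set
Path u x t w = (walk x w ≡ t) × All Ballot (pointsFrom x w) × All (HeightAtMost u) (pointsFrom x w)

path? : ∀ u x t → Decidable (Path u x t)
path? u x t w = ≡-dec _≟_ (walk x w) t
                ×-dec (all? ballot? (pointsFrom x w) ×-dec all? (heightAtMost? u) (pointsFrom x w))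

#paths : ℕ → Point → Point → ℕ → ℕ
#paths u x t k = length (filter (path? u x t) (words k))

Good≐Path : ∀ u n → Good u n ≐ Path u origin (replicate 4 n)
Good≐Path u n = (λ {w} (end , ballot , height) → trans (sym (finalPoint≡walk w)) end , ballot , height)
              , (λ {w} (end , ballot , height) → trans (finalPoint≡walk w) end , ballot , height)

Chat4≡#paths : ∀ u n → Chat4 u n ≡ #paths u origin (replicate 4 n) (4 * n)
Chat4≡#paths u n = cong length (filter-≐ _ (path? u origin (replicate 4 n)) (Good≐Path u n) (words (4 * n)))

path-admissible : ∀ u {x t} w → Path u x t w → Admissible u x
path-admissible u []      (_ , ballot ∷ _ , height ∷ _) = ballot , height
path-admissible u (_ ∷ _) (_ , ballot ∷ _ , height ∷ _) = ballot , height

path-∷ : ∀ u {x t} s → Admissible u x → Path u x t ∘ (s ∷_) ≐ Path u (addStep x s) t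
path-∷ u s (ballotₓ , heightₓ) = (λ { (end , _ ∷ ballot , _ ∷ height) → end , ballot , height })
                             , (λ (end , ballot , height) → end , ballotₓ ∷ ballot , heightₓ ∷ height)

#paths-inadmissible : ∀ u {x} t k → ¬ Admissible u x → #paths u x t k ≡ 0
#paths-inadmissible u {x} t k ¬adm =
  cong length (filter-none (path? u x t) (universal (λ w → ¬adm ∘ path-admissible u w) (words k)))

-- Inadmissible successors are filtered out so that, at a concrete point, the right-hand
-- side evaluates to a sum over its admissible successors only.
#paths-suc : ∀ u {x} t k → Admissible u x →
  #paths u x t (suc k)
    ≡ sum (map (λ s → #paths u (addStep x s) t k) (filter (admissible? u ∘ addStep x) allFin4))
#paths-suc u {x} t k adm = begin
  length (filter (path? u x t) (concatMap (λ s → map (s ∷_) (words k)) allFin4))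
    ≡⟨ length-filter-concatMap (path? u x t) (λ s → map (s ∷_) (words k)) allFin4 ⟩
  sum (map (λ s → length (filter (path? u x t) (map (s ∷_) (words k)))) allFin4)
    ≡⟨ cong sum (map-cong first-step allFin4) ⟩
  sum (map (λ s → #paths u (addStep x s) t k) allFin4)
    ≡⟨ sum-map-filter (admissible? u ∘ addStep x) _ (λ s → #paths-inadmissible u t k) allFin4 ⟨
  sum (map (λ s → #paths u (addStep x s) t k) (filter (admissible? u ∘ addStep x) allFin4)) ∎
  where
  open ≡-Reasoning
  first-step : ∀ s → length (filter (path? u x t) (map (s ∷_) (words k))) ≡ #paths u (addStep x s) t k
  first-step s = trans (length-filter-map (path? u x t) (s ∷_) (words k))
                       (cong length (filter-≐ _ (path? u (addStep x s) t) (path-∷ u s adm) (words k)))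

shift : Point → Point
shift = Vec.map suc

shift-injective : ∀ {x y} → shift x ≡ shift y → x ≡ y
shift-injective {_ ∷ _ ∷ _ ∷ _ ∷ []} {_ ∷ _ ∷ _ ∷ _ ∷ []} refl = refl

shift-addStep : ∀ x s → shift (addStep x s) ≡ addStep (shift x) s
shift-addStep x s = map-updateAt x s refl

walk-shift : ∀ x w → walk (shift x) w ≡ shift (walk x w)
walk-shift x []      = refl
walk-shift x (s ∷ w) = trans (cong (λ y → walk y w) (sym (shift-addStep x s))) (walk-shift (addStep x s) w)

pointsFrom-shift : ∀ x w → pointsFrom (shift x) w ≡ map shift (pointsFrom x w)
pointsFrom-shift x []      = refl
pointsFrom-shift x (s ∷ w) = cong (shift x ∷_)
  (trans (cong (λ y → pointsFrom y w) (sym (shift-addStep x s))) (pointsFrom-shift (addStep x s) w))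

ballot-shift : Ballot ∘ shift ≐ Ballot
ballot-shift = (λ { {_ ∷ _ ∷ _ ∷ _ ∷ []} (p , q , r) → s≤s⁻¹ p , s≤s⁻¹ q , s≤s⁻¹ r })
             , (λ { {_ ∷ _ ∷ _ ∷ _ ∷ []} (p , q , r) → s≤s p , s≤s q , s≤s r })

-- The weights of g₄ sum to 0, so in the subtraction-free form both sides grow by 4.
height-shift : ∀ u → HeightAtMost u ∘ shift ≐ HeightAtMost u
height-shift u = (λ { {a ∷ b ∷ c ∷ d ∷ []} h → +-cancelˡ-≤ 4 _ _ (subst₂ _≤_ (lhs a b) (rhs c d) h) })
               , (λ { {a ∷ b ∷ c ∷ d ∷ []} h → subst₂ _≤_ (sym (lhs a b)) (sym (rhs c d)) (+-monoʳ-≤ 4 h) })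
  where
  open +-*-Solver
  lhs : ∀ a b → 3 * suc a + suc b ≡ 4 + (3 * a + b)
  lhs = solve 2 (λ a b → con 3 :* (con 1 :+ a) :+ (con 1 :+ b) := con 4 :+ (con 3 :* a :+ b)) refl
  rhs : ∀ c d → u + suc c + 3 * suc d ≡ 4 + (u + c + 3 * d)
  rhs = solve 3 (λ u c d → u :+ (con 1 :+ c) :+ con 3 :* (con 1 :+ d) := con 4 :+ (u :+ c :+ con 3 :* d)) refl u

All-pointsFrom-shift : ∀ {ℓ} {P : Pred Point ℓ} → P ∘ shift ≐ P → ∀ x →
  All P ∘ pointsFrom (shift x) ≐ All P ∘ pointsFrom x
All-pointsFrom-shift {P = P} (to , from) x =
    (λ {w} ps → All.map to (map⁻ (subst (All P) (pointsFrom-shift x w) ps)))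
  , (λ {w} ps → subst (All P) (sym (pointsFrom-shift x w)) (map⁺ (All.map from ps)))

path-shift : ∀ u x t → Path u (shift x) (shift t) ≐ Path u x t
path-shift u x t =
    (λ {w} (end , ballot , height) → shift-injective (trans (sym (walk-shift x w)) end)
                                   , proj₁ (All-pointsFrom-shift ballot-shift x) ballot
                                   , proj₁ (All-pointsFrom-shift (height-shift u) x) height)
  , (λ {w} (end , ballot , height) → trans (walk-shift x w) (cong shift end)
                                   , proj₂ (All-pointsFrom-shift ballot-shift x) ballot
                                   , proj₂ (All-pointsFrom-shift (height-shift u) x) height)

#paths-shift : ∀ u x t k → #paths u (shift x) (shift t) k ≡ #paths u x t k
#paths-shift u x t k =
  cong length (filter-≐ (path? u (shift x) (shift t)) (path? u x t) (path-shift u x t) (words k))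

#paths-from-2000 : ∀ t k → #paths 6 (2 ∷ 0 ∷ 0 ∷ 0 ∷ []) t (suc k) ≡ 0
#paths-from-2000 t k = #paths-suc 6 t k (from-yes (admissible? 6 (2 ∷ 0 ∷ 0 ∷ 0 ∷ [])))

#paths-from-1100 : ∀ t k → #paths 6 (1 ∷ 1 ∷ 0 ∷ 0 ∷ []) t (suc k) ≡ #paths 6 (1 ∷ 1 ∷ 1 ∷ 0 ∷ []) t k
#paths-from-1100 t k = trans (#paths-suc 6 t k (from-yes (admissible? 6 (1 ∷ 1 ∷ 0 ∷ 0 ∷ [])))) (+-identityʳ _)

#paths-from-1000 : ∀ t k → #paths 6 (1 ∷ 0 ∷ 0 ∷ 0 ∷ []) t (2 + k) ≡ #paths 6 (1 ∷ 1 ∷ 1 ∷ 0 ∷ []) t k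
#paths-from-1000 t k = begin
  #paths 6 (1 ∷ 0 ∷ 0 ∷ 0 ∷ []) t (2 + k)
    ≡⟨ #paths-suc 6 t (suc k) (from-yes (admissible? 6 (1 ∷ 0 ∷ 0 ∷ 0 ∷ []))) ⟩
  #paths 6 (2 ∷ 0 ∷ 0 ∷ 0 ∷ []) t (suc k) + (#paths 6 (1 ∷ 1 ∷ 0 ∷ 0 ∷ []) t (suc k) + 0)
    ≡⟨ cong₂ (λ a b → a + (b + 0)) (#paths-from-2000 t k) (#paths-from-1100 t k) ⟩
  #paths 6 (1 ∷ 1 ∷ 1 ∷ 0 ∷ []) t k + 0
    ≡⟨ +-identityʳ _ ⟩
  #paths 6 (1 ∷ 1 ∷ 1 ∷ 0 ∷ []) t k ∎
  where open ≡-Reasoning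

#paths-from-origin : ∀ t k → #paths 6 origin t (3 + k) ≡ #paths 6 (1 ∷ 1 ∷ 1 ∷ 0 ∷ []) t k
#paths-from-origin t k = trans (#paths-suc 6 t (2 + k) (from-yes (admissible? 6 origin)))
                               (trans (+-identityʳ _) (#paths-from-1000 t k))

#paths-from-2110 : ∀ t k →
  #paths 6 (2 ∷ 1 ∷ 1 ∷ 0 ∷ []) (shift t) (3 + k) ≡ #paths 6 (1 ∷ 1 ∷ 1 ∷ 0 ∷ []) t k
#paths-from-2110 t k = begin
  #paths 6 (2 ∷ 1 ∷ 1 ∷ 0 ∷ []) (shift t) (3 + k)
    ≡⟨ #paths-suc 6 (shift t) (2 + k) (from-yes (admissible? 6 (2 ∷ 1 ∷ 1 ∷ 0 ∷ []))) ⟩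
  #paths 6 (shift (1 ∷ 0 ∷ 0 ∷ 0 ∷ [])) (shift t) (2 + k) + 0
    ≡⟨ +-identityʳ _ ⟩
  #paths 6 (shift (1 ∷ 0 ∷ 0 ∷ 0 ∷ [])) (shift t) (2 + k)
    ≡⟨ #paths-shift 6 (1 ∷ 0 ∷ 0 ∷ 0 ∷ []) t (2 + k) ⟩
  #paths 6 (1 ∷ 0 ∷ 0 ∷ 0 ∷ []) t (2 + k)
    ≡⟨ #paths-from-1000 t k ⟩
  #paths 6 (1 ∷ 1 ∷ 1 ∷ 0 ∷ []) t k ∎
  where open ≡-Reasoning

#paths-from-1110 : ∀ t k →
  #paths 6 (1 ∷ 1 ∷ 1 ∷ 0 ∷ []) (shift t) (4 + k) ≡ 2 * #paths 6 (1 ∷ 1 ∷ 1 ∷ 0 ∷ []) t k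
#paths-from-1110 t k = begin
  #paths 6 (1 ∷ 1 ∷ 1 ∷ 0 ∷ []) (shift t) (4 + k)
    ≡⟨ #paths-suc 6 (shift t) (3 + k) (from-yes (admissible? 6 (1 ∷ 1 ∷ 1 ∷ 0 ∷ []))) ⟩
  #paths 6 (2 ∷ 1 ∷ 1 ∷ 0 ∷ []) (shift t) (3 + k) + (#paths 6 (shift origin) (shift t) (3 + k) + 0)
    ≡⟨ cong₂ (λ a b → a + (b + 0)) (#paths-from-2110 t k)
                                  (trans (#paths-shift 6 origin t (3 + k)) (#paths-from-origin t k)) ⟩
  2 * #paths 6 (1 ∷ 1 ∷ 1 ∷ 0 ∷ []) t k ∎
  where open ≡-Reasoning

#paths-from-1110-to-diagonal : ∀ m →
  #paths 6 (1 ∷ 1 ∷ 1 ∷ 0 ∷ []) (replicate 4 (suc m)) (suc (m * 4)) ≡ 2 ^ m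
#paths-from-1110-to-diagonal zero    = refl
#paths-from-1110-to-diagonal (suc m) =
  trans (#paths-from-1110 (replicate 4 (suc m)) (suc (m * 4)))
        (cong (2 *_) (#paths-from-1110-to-diagonal m))

corollary4p6 : (m : ℕ) → Chat4 6 (suc m) ≡ 2 ^ m
corollary4p6 m = begin
  Chat4 6 (suc m)
    ≡⟨ Chat4≡#paths 6 (suc m) ⟩
  #paths 6 origin t (4 * suc m)
    ≡⟨ cong (#paths 6 origin t) (*-comm 4 (suc m)) ⟩
  #paths 6 origin t (3 + suc (m * 4))
    ≡⟨ #paths-from-origin t (suc (m * 4)) ⟩
  #paths 6 (1 ∷ 1 ∷ 1 ∷ 0 ∷ []) t (suc (m * 4))
    ≡⟨ #paths-from-1110-to-diagonal m ⟩
  2 ^ m ∎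
  where
  open ≡-Reasoning
  t = replicate 4 (suc m)
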